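{- Let $R$ be a right fountain triangulation of $\mathbb{N}$ with fountain point $0$ and let $\mu(R)$ be the mutation of $R$ at an arc of $R$ which is not of the form $(0,\boldsymbol{y}^R_n)$ or $(\boldsymbol{y}^R_n,\boldsymbol{y}^R_{n+1})$. Then $\boldsymbol{x}^R=\boldsymbol{x}^{\mu(R)}$.
   Context: Arcs are pairs $(a,b)$ of integers with $0\le a<b$; arcs $(a,b),(c,d)$ cross if $a<c<b<d$ or $c<a<d<b$. A triangulation of $\mathbb{N}$ is a maximal set of pairwise noncrossing arcs. A right fountain triangulation with fountain point $0$ is such a triangulation $R$ containing $(0,n)$ for infinitely many $n$. $\boldsymbol{x}^R_n=1$ if $(0,n+1)\in R$ and $0$ otherwise ($n\ge1$); $\boldsymbol{y}^R_n$ is the $(n+1)$-st positive integer $\ell$ with $(0,\ell)\in R$. Mutation at a non-boundary arc $\gamma\in R$: $\gamma$ is the diagonal of a unique quadrilateral formed by two triangles of $R$, and $\mu(R)$ replaces $\gamma$ with the other diagonal. -}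

module Defs where

open import Data.Nat using (ℕ; zero; suc; _+_; _≤_; _<_; _≟_)
open import Data.Bool using (Bool; true; false; if_then_else_; _∧_)
open import Data.Product using (Σ; _×_; _,_; ∃-syntax)
open import Data.Sum using (_⊎_)
open import Relation.Nullary using (¬_)
open import Relation.Nullary.Decidable using (⌊_⌋)
open import Relation.Binary.PropositionalEquality using (_≡_)

ArcSet : Set
ArcSet = ℕ → ℕ → Bool

_∈A_ : ℕ × ℕ → ArcSet → Set
(a , b) ∈A S = S a b ≡ true

Cross : ℕ → ℕ → ℕ → ℕ → Set
Cross a b c d = (a < c × c < b × b < d) ⊎ (c < a × a < d × d < b)

OnlyArcs : ArcSet → Set
OnlyArcs S = ∀ a b → (a , b) ∈A S → a < b

PairwiseNoncrossing : ArcSet → Set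
PairwiseNoncrossing S =
  ∀ a b c d → (a , b) ∈A S → (c , d) ∈A S → ¬ Cross a b c d

Maximal : ArcSet → Set
Maximal S = ∀ a b → a < b →
  (∀ c d → (c , d) ∈A S → ¬ Cross a b c d) → (a , b) ∈A S

IsTriangulation : ArcSet → Set
IsTriangulation S = OnlyArcs S × PairwiseNoncrossing S × Maximal S

IsRightFountain0 : ArcSet → Set
IsRightFountain0 R = ∀ m → ∃[ n ] (m ≤ n × (0 , n) ∈A R)

countBelow : ArcSet → ℕ → ℕ
countBelow R zero = 0
countBelow R (suc zero) = 0
countBelow R (suc (suc k)) =
  countBelow R (suc k) + (if R 0 (suc k) then 1 else 0)

-- IsY R n ℓ : ℓ = y^R_n, the (n+1)-st positive integer ℓ with (0,ℓ) ∈ R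
IsY : ArcSet → ℕ → ℕ → Set
IsY R n ℓ = 1 ≤ ℓ × (0 , ℓ) ∈A R × countBelow R ℓ ≡ n

-- x^R_n  (meaningful for n ≥ 1)
xR : ArcSet → ℕ → ℕ
xR R n = if R 0 (suc n) then 1 else 0

NonBoundary : ℕ → ℕ → Set
NonBoundary a b = suc a < b

-- γ = (a,b) and δ = (c,d) are the two diagonals of a quadrilateral
-- p<q<r<s formed by two triangles of R sharing γ
-- (sides (p,q),(q,r),(r,s),(p,s) and γ all lie in R)
QuadDiagonals : ArcSet → ℕ → ℕ → ℕ → ℕ → Set
QuadDiagonals R a b c d =
  ∃[ p ] ∃[ q ] ∃[ r ] ∃[ s ]
    ( p < q × q < r × r < s
    × (p , q) ∈A R × (q , r) ∈A R × (r , s) ∈A R × (p , s) ∈A R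
    × ( (a ≡ p × b ≡ r × c ≡ q × d ≡ s)
      ⊎ (a ≡ q × b ≡ s × c ≡ p × d ≡ r)))

replaceArc : ArcSet → ℕ → ℕ → ℕ → ℕ → ArcSet
replaceArc R a b c d i j =
  if ⌊ i ≟ a ⌋ ∧ ⌊ j ≟ b ⌋ then false
  else if ⌊ i ≟ c ⌋ ∧ ⌊ j ≟ d ⌋ then true
  else R i j

{-# OPTIONS --safe #-}
module Submission where

open import Defs
open import Data.Nat using (ℕ; suc; _≤_; _<_; _<′_; <′-base; <′-step; _+_; _≟_)
open import Data.Nat.Properties using (+-comm; +-identityʳ; <-trans; n<1+n; m<n⇒m<1+n; <⇒<′; <′⇒<)
open import Data.Bool using (false; if_then_else_)
open import Data.Bool.Properties using (¬-not)
open import Data.Product using (_×_; _,_; ∃-syntax)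
open import Data.Sum using (inj₁; inj₂)
open import Relation.Nullary using (¬_; yes; no; contradiction)
open import Relation.Binary.PropositionalEquality using (_≡_; _≢_; refl; sym; cong; subst; module ≡-Reasoning)

-- Mutation removes (a,b) and adds (c,d); x^R only sees the arcs (0,ℓ), so it suffices that
-- a ≠ 0 and c ≠ 0. If a = 0 then (a,b) = (0,y_n) for some n. If c = 0 then the quadrilateral
-- is 0 < a < d < b with (0,a), (0,b) ∈ R, and since (a,b) ∈ R blocks every (0,ℓ) with
-- a < ℓ < b, the arc (a,b) is (y_n, y_{n+1}) for some n.

module _ {R : ArcSet} where

  open ≡-Reasoning

  fountainArc-IsY : OnlyArcs R → ∀ {ℓ} → (0 , ℓ) ∈A R → IsY R (countBelow R ℓ) ℓ
  fountainArc-IsY onlyArcs {ℓ} 0ℓ∈R = onlyArcs 0 ℓ 0ℓ∈R , 0ℓ∈R , refl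

  noFountainArc-under : PairwiseNoncrossing R → ∀ {q s ℓ} → 0 < q → (q , s) ∈A R →
    q < ℓ → ℓ < s → R 0 ℓ ≡ false
  noFountainArc-under noncrossing 0<q qs∈R q<ℓ ℓ<s =
    ¬-not λ 0ℓ∈R → noncrossing 0 _ _ _ 0ℓ∈R qs∈R (inj₁ (0<q , q<ℓ , ℓ<s))

  countBelow-suc : ∀ {k} → 0 < k → countBelow R (suc k) ≡ countBelow R k + (if R 0 k then 1 else 0)
  countBelow-suc {suc k} _ = refl

  countBelow-gap : ∀ {q s} → 0 < q → q <′ s → (0 , q) ∈A R →
    (∀ ℓ → q < ℓ → ℓ < s → R 0 ℓ ≡ false) →
    countBelow R s ≡ suc (countBelow R q)
  countBelow-gap {q} 0<q <′-base 0q∈R _ = begin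
    countBelow R (suc q)                      ≡⟨ countBelow-suc 0<q ⟩
    countBelow R q + (if R 0 q then 1 else 0) ≡⟨ cong (λ t → countBelow R q + (if t then 1 else 0)) 0q∈R ⟩
    countBelow R q + 1                        ≡⟨ +-comm _ 1 ⟩
    suc (countBelow R q)                      ∎
  countBelow-gap {q} 0<q (<′-step {s} q<′s) 0q∈R gap = begin
    countBelow R (suc s)                      ≡⟨ countBelow-suc (<-trans 0<q q<s) ⟩
    countBelow R s + (if R 0 s then 1 else 0) ≡⟨ cong (λ t → countBelow R s + (if t then 1 else 0)) (gap s q<s (n<1+n s)) ⟩
    countBelow R s + 0                        ≡⟨ +-identityʳ _ ⟩
    countBelow R s                            ≡⟨ countBelow-gap 0<q q<′s 0q∈R (λ ℓ q<ℓ ℓ<s → gap ℓ q<ℓ (m<n⇒m<1+n ℓ<s)) ⟩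
    suc (countBelow R q)                      ∎
    where
    q<s : q < s
    q<s = <′⇒< q<′s

  consecutiveFountainArcs-IsY : IsTriangulation R → ∀ {q s} → 0 < q → q < s →
    (0 , q) ∈A R → (0 , s) ∈A R → (q , s) ∈A R →
    IsY R (countBelow R q) q × IsY R (suc (countBelow R q)) s
  consecutiveFountainArcs-IsY (onlyArcs , noncrossing , _) {q} {s} 0<q q<s 0q∈R 0s∈R qs∈R =
    fountainArc-IsY onlyArcs 0q∈R ,
    subst (λ n → IsY R n s) countBelow-s (fountainArc-IsY onlyArcs 0s∈R)
    where
    countBelow-s : countBelow R s ≡ suc (countBelow R q)
    countBelow-s = countBelow-gap 0<q (<⇒<′ q<s) 0q∈R (λ ℓ → noFountainArc-under noncrossing 0<q qs∈R)

  QuadDiagonals-0⇒fountainArcs : ∀ {a b d} → QuadDiagonals R a b 0 d →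
    0 < a × a < b × (0 , a) ∈A R × (0 , b) ∈A R
  QuadDiagonals-0⇒fountainArcs (_ , _ , _ , _ , () , _ , _ , _ , _ , _ , _ , inj₁ (_ , _ , refl , _))
  QuadDiagonals-0⇒fountainArcs (_ , _ , _ , _ , p<q , q<r , r<s , pq∈R , _ , _ , ps∈R , inj₂ (refl , refl , refl , _)) =
    p<q , <-trans q<r r<s , pq∈R , ps∈R

  replaceArc-fountainArc : ∀ {a b c d} → a ≢ 0 → c ≢ 0 → ∀ ℓ → replaceArc R a b c d 0 ℓ ≡ R 0 ℓ
  replaceArc-fountainArc {a} {c = c} a≢0 c≢0 ℓ with 0 ≟ a | 0 ≟ c
  ... | yes 0≡a | _       = contradiction (sym 0≡a) a≢0
  ... | no _    | yes 0≡c = contradiction (sym 0≡c) c≢0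
  ... | no _    | no _    = refl

lemma3p13 : (R : ArcSet) → IsTriangulation R → IsRightFountain0 R →
    (a b : ℕ) → (a , b) ∈A R → NonBoundary a b →
    ¬ (∃[ n ] ∃[ ℓ ] (IsY R n ℓ × a ≡ 0 × b ≡ ℓ)) →
    ¬ (∃[ n ] ∃[ ℓ ] ∃[ ℓ′ ] (IsY R n ℓ × IsY R (suc n) ℓ′ × a ≡ ℓ × b ≡ ℓ′)) →
    (c d : ℕ) → QuadDiagonals R a b c d →
    ∀ n → 1 ≤ n → xR R n ≡ xR (replaceArc R a b c d) n
lemma3p13 R triang@(onlyArcs , _ , _) _ a b ab∈R _ notFountainY notConsecutiveY c d quad n _ =
  cong (λ t → if t then 1 else 0) (sym (replaceArc-fountainArc {R} a≢0 c≢0 (suc n)))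
  where
  a≢0 : a ≢ 0
  a≢0 refl = notFountainY (_ , b , fountainArc-IsY onlyArcs ab∈R , refl , refl)

  c≢0 : c ≢ 0
  c≢0 refl with QuadDiagonals-0⇒fountainArcs quad
  ... | 0<a , a<b , 0a∈R , 0b∈R
      with consecutiveFountainArcs-IsY triang 0<a a<b 0a∈R 0b∈R ab∈R
  ... | a-IsY , b-IsY = notConsecutiveY (_ , a , b , a-IsY , b-IsY , refl , refl)
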